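{- Let $\lambda$ be a nonzero real number, $m$ a positive integer, $n\ge0$ an integer, and $p(x)\in\mathbb{C}[x]$ a polynomial of degree at most $n$. Then $$p(x)=\sum_{k=0}^{n}C_k\,d_{m,\lambda}(k,x),\qquad\text{where } C_k=\frac{1}{k!}\Big\langle (mt+1)^{ -\frac{1}{m}}\Big(\frac{1}{m}\log_{\frac{\lambda}{m}}(1+mt)\Big)^{k}\,\Big|\,p(x)\Big\rangle_\lambda .$$
   Context: For $\mu\neq 0$: $(x)_{0,\mu}=1$ and $(x)_{n,\mu}=x(x-\mu)\cdots(x-(n-1)\mu)$ for $n\ge1$; $e_\mu^{x}(t)=\sum_{k\ge0}(x)_{k,\mu}\frac{t^k}{k!}=(1+\mu t)^{x/\mu}$, $e_\mu(t)=e^1_\mu(t)$, and $\log_\mu(1+t)=\frac{1}{\mu}\big((1+t)^\mu-1\big)$ is the compositional inverse of $e_\mu(t)$; in particular $\log_{\lambda/m}(1+mt)=\frac{m}{\lambda}\big((1+mt)^{\lambda/m}-1\big)$. For a formal power series $f(t)=\sum_{k\ge0}a_k\frac{t^k}{k!}$, $\langle f(t)\,|\,\cdot\,\rangle_\lambda$ is the linear functional on $\mathbb{C}[x]$ determined by $\langle f(t)\,|\,(x)_{k,\lambda}\rangle_\lambda=a_k$ for all $k\ge0$. The degenerate Whitney numbers of the second kind are defined by $e_\lambda(t)\frac{1}{k!}\Big(\frac{e_\lambda^{m}(t)-1}{m}\Big)^k=\sum_{n\ge k}W_{m,\lambda}(n,k)\frac{t^n}{n!}$, and the fully degenerate Dowling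 polynomials are $d_{m,\lambda}(n,x)=\sum_{k=0}^{n}W_{m,\lambda}(n,k)(x)_{k,\lambda}$. -}

module Defs where

open import Level using (Level)
open import Data.Nat as ℕ using (ℕ; zero; suc)
open import Data.Nat.Combinatorics using (_C_)
open import Algebra.Bundles using (CommutativeRing)

-- Everything is parameterised by a commutative ring R together with an
-- "inverse" operation inv (the field axioms are hypotheses of the theorem).
module FD {c ℓ : Level} (R : CommutativeRing c ℓ) (inv : CommutativeRing.Carrier R → CommutativeRing.Carrier R) where
  open CommutativeRing R

  natR : ℕ → Carrier
  natR zero    = 0#
  natR (suc n) = 1# + natR n

  factR : ℕ → Carrier
  factR zero    = 1#
  factR (suc n) = natR (suc n) * factR n

  sumTo : ℕ → (ℕ → Carrier) → Carrier
  sumTo zero    f = f 0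
  sumTo (suc n) f = sumTo n f + f (suc n)

  fall : Carrier → Carrier → ℕ → Carrier
  fall x μ zero    = 1#
  fall x μ (suc k) = fall x μ k * (x - natR k * μ)

  -- Formal power series represented by their EGF coefficients:
  -- a : ℕ → Carrier stands for Σ_k a k t^k / k!.
  EGF : Set c
  EGF = ℕ → Carrier

  egfMul : EGF → EGF → EGF
  egfMul a b n = sumTo n (λ i → natR (n C i) * (a i * b (n ℕ.∸ i)))

  egfOne : EGF
  egfOne zero    = 1#
  egfOne (suc _) = 0#

  egfPow : EGF → ℕ → EGF
  egfPow a zero    = egfOne
  egfPow a (suc k) = egfMul (egfPow a k) a

  -- e_μ^x(t) = (1 + μ t)^{x/μ} has EGF coefficients (x)_{k,μ}
  eDeg : Carrier → Carrier → EGF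
  eDeg μ x = fall x μ

  -- Polynomials in x, represented by coefficient sequences (coeff of x^i).
  Poly : Set c
  Poly = ℕ → Carrier

  polyAdd : Poly → Poly → Poly
  polyAdd p q i = p i + q i

  polyScale : Carrier → Poly → Poly
  polyScale a p i = a * p i

  polyMulX : Poly → Poly
  polyMulX p zero    = 0#
  polyMulX p (suc i) = p i

  polySum : ℕ → (ℕ → Poly) → Poly
  polySum n f i = sumTo n (λ k → f k i)

  polyFall : Carrier → ℕ → Poly
  polyFall μ zero    = λ i → egfOne i
  polyFall μ (suc k) = polyAdd (polyMulX (polyFall μ k)) (polyScale (- (natR k * μ)) (polyFall μ k))

  module Params (lam : Carrier) (m : ℕ) where
    mR : Carrier
    mR = natR m

    -- (e_λ^m(t) - 1)/m
    whitArg : EGF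
    whitArg zero    = 0#
    whitArg (suc j) = inv mR * eDeg lam mR (suc j)

    -- degenerate Whitney numbers of the second kind W_{m,λ}(n,k):
    -- e_λ(t) (1/k!) ((e_λ^m(t)-1)/m)^k = Σ_n W(n,k) t^n/n!
    W : ℕ → ℕ → Carrier
    W n k = inv (factR k) * egfMul (eDeg lam 1#) (egfPow whitArg k) n

    dowling : ℕ → Poly
    dowling n = polySum n (λ k → polyScale (W n k) (polyFall lam k))

    -- degenerate Stirling numbers of the second kind: x^n = Σ_k S(n,k) (x)_{k,λ}
    -- (coordinates of the monomials in the basis (x)_{k,λ})
    S : ℕ → ℕ → Carrier
    S zero    zero    = 1#
    S zero    (suc k) = 0#
    S (suc n) zero    = 0#
    S (suc n) (suc k) = S n k + natR (suc k) * lam * S n (suc k)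

    -- ⟨ f(t) | p(x) ⟩_λ for p of degree ≤ N, where f = Σ a_k t^k/k!:
    -- the linear functional with ⟨ f | (x)_{k,λ} ⟩_λ = a_k, evaluated on
    -- p = Σ_{j≤N} p_j x^j = Σ_{j≤N} p_j Σ_k S(j,k) (x)_{k,λ}.
    pairing : ℕ → EGF → Poly → Carrier
    pairing N a p = sumTo N (λ j → p j * sumTo j (λ k → S j k * a k))

    -- (mt+1)^{-1/m} = e_m^{-1}(t)
    factorA : EGF
    factorA = eDeg mR (- 1#)

    -- (1/m) log_{λ/m}(1+mt) = (1/λ) ((1+mt)^{λ/m} - 1) = (1/λ)(e_m^λ(t) - 1)
    factorG : EGF
    factorG zero    = 0#
    factorG (suc j) = inv lam * eDeg mR lam (suc j)

    coeffC : ℕ → Poly → ℕ → Carrier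
    coeffC N p k = inv (factR k) * pairing N (egfMul factorA (egfPow factorG k)) p

{-# OPTIONS --safe #-}
module Submission where

-- Expand p in the basis of degenerate falling factorials, p = Σ_a x_a (x)_{a,λ}, the coordinates
-- x_a coming from the degenerate Stirling numbers. Then C_k = Σ_a x_a A(k,a) and
-- d_{m,λ}(k,x) = Σ_l B(l,k) (x)_{l,λ}, where A(k,·) and B(l,·) are the coefficients of
-- (1+mt)^{-1/m} G^k/k! and e_λ(t) F^l/l! with G = (e_m^λ − 1)/λ and F = (e_λ^m − 1)/m. The lower
-- triangular matrices A and B are mutually inverse (G and F are compositional inverses, and
-- (1+mF)^{-1/m} = 1/e_λ), so Σ_k C_k d_{m,λ}(k,x) collapses to Σ_a x_a (x)_{a,λ} = p.
-- Instead of composing power series, A and B are characterised by first order recurrences: each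
-- family g f^k/k! with (1+ct)g' = αg and (1+ct)f' = 1 + βf satisfies
-- (1+ct)(g f^k/k!)' = (α + kβ) g f^k/k! + g f^{k-1}/(k-1)!, and for A and B the roles of the
-- parameters c and β are exchanged, which makes A·B = 1 follow by induction on the column index.

open import Defs
open import Level using (Level)
open import Data.Nat as ℕ using (ℕ; zero; suc; _<_; _≤_; z≤n; s≤s; _∸_)
import Data.Nat.Properties as ℕₚ
open import Data.Nat.Combinatorics using (_C_; nCn≡1; k>n⇒nCk≡0; nCk+nC[k+1]≡[n+1]C[k+1])
open import Data.Empty using (⊥-elim)
open import Relation.Nullary using (¬_; yes; no)
open import Relation.Binary.PropositionalEquality as ≡ using (_≡_; _≢_)
open import Algebra.Bundles using (CommutativeRing)
import Relation.Binary.Reasoning.Setoid as SetoidReasoning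

module Dowling {c ℓ : Level} (R : CommutativeRing c ℓ)
                (inv : CommutativeRing.Carrier R → CommutativeRing.Carrier R) where
  open CommutativeRing R hiding (zero)
  open FD R inv
  open import Algebra.Properties.CommutativeSemigroup +-commutativeSemigroup
    using () renaming (interchange to +-interchange; x∙yz≈y∙xz to x+yz≈y+xz)
  open import Algebra.Properties.CommutativeSemigroup *-commutativeSemigroup
    using () renaming (x∙yz≈y∙xz to x*yz≈y*xz)
  open import Algebra.Properties.Group +-group using () renaming (∙-cancelʳ to +-cancelʳ; ε⁻¹≈ε to -0#≈0#)
  open SetoidReasoning setoid
  open import Algebra.Solver.Ring.NaturalCoefficients.Default commutativeSemiring
    using (solve; _:=_; _:+_; _:*_; con)

  sumTo-cong : ∀ n {f g : ℕ → Carrier} → (∀ k → f k ≈ g k) → sumTo n f ≈ sumTo n g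
  sumTo-cong zero    f≈g = f≈g 0
  sumTo-cong (suc n) f≈g = +-cong (sumTo-cong n f≈g) (f≈g (suc n))

  sumTo-cong≤ : ∀ n {f g : ℕ → Carrier} → (∀ k → k ≤ n → f k ≈ g k) → sumTo n f ≈ sumTo n g
  sumTo-cong≤ zero    f≈g = f≈g 0 z≤n
  sumTo-cong≤ (suc n) f≈g =
    +-cong (sumTo-cong≤ n (λ k k≤n → f≈g k (ℕₚ.m≤n⇒m≤1+n k≤n))) (f≈g (suc n) ℕₚ.≤-refl)

  sumTo-distrib-+ : ∀ n (f g : ℕ → Carrier) → sumTo n (λ k → f k + g k) ≈ sumTo n f + sumTo n g
  sumTo-distrib-+ zero    f g = refl
  sumTo-distrib-+ (suc n) f g = trans (+-congʳ (sumTo-distrib-+ n f g)) (+-interchange _ _ _ _)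

  sumTo-distribˡ : ∀ n a (f : ℕ → Carrier) → sumTo n (λ k → a * f k) ≈ a * sumTo n f
  sumTo-distribˡ zero    a f = refl
  sumTo-distribˡ (suc n) a f = trans (+-congʳ (sumTo-distribˡ n a f)) (sym (distribˡ a _ _))

  sumTo-distribʳ : ∀ n a (f : ℕ → Carrier) → sumTo n (λ k → f k * a) ≈ sumTo n f * a
  sumTo-distribʳ n a f =
    trans (sumTo-cong n (λ k → *-comm (f k) a)) (trans (sumTo-distribˡ n a f) (*-comm a _))

  sumTo-zero : ∀ n (f : ℕ → Carrier) → (∀ k → k ≤ n → f k ≈ 0#) → sumTo n f ≈ 0#
  sumTo-zero zero    f f≈0 = f≈0 0 z≤n
  sumTo-zero (suc n) f f≈0 =
    trans (+-cong (sumTo-zero n f (λ k k≤n → f≈0 k (ℕₚ.m≤n⇒m≤1+n k≤n))) (f≈0 (suc n) ℕₚ.≤-refl))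
          (+-identityʳ 0#)

  sumTo-suc : ∀ n (f : ℕ → Carrier) → sumTo (suc n) f ≈ f 0 + sumTo n (λ k → f (suc k))
  sumTo-suc zero    f = refl
  sumTo-suc (suc n) f = trans (+-congʳ (sumTo-suc n f)) (+-assoc _ _ _)

  sumTo-comm : ∀ n m (f : ℕ → ℕ → Carrier) →
               sumTo n (λ i → sumTo m (f i)) ≈ sumTo m (λ j → sumTo n (λ i → f i j))
  sumTo-comm zero    m f = refl
  sumTo-comm (suc n) m f =
    trans (+-congʳ (sumTo-comm n m f)) (sym (sumTo-distrib-+ m (λ j → sumTo n (λ i → f i j)) (f (suc n))))

  sumTo-bilinear-assoc : ∀ n (x y : ℕ → Carrier) (M M′ : ℕ → ℕ → Carrier) →
    sumTo n (λ k → sumTo n (λ a → x a * M k a) * sumTo n (λ l → M′ l k * y l)) ≈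
    sumTo n (λ a → x a * sumTo n (λ l → sumTo n (λ k → M k a * M′ l k) * y l))
  sumTo-bilinear-assoc n x y M M′ = begin
    sumTo n (λ k → sumTo n (λ a → x a * M k a) * sumTo n (λ l → M′ l k * y l))
      ≈⟨ sumTo-cong n (λ k → trans (sym (sumTo-distribʳ n _ _)) (sumTo-cong n (λ a → sym (sumTo-distribˡ n _ _)))) ⟩
    sumTo n (λ k → sumTo n (λ a → sumTo n (λ l → (x a * M k a) * (M′ l k * y l))))
      ≈⟨ sumTo-comm n n _ ⟩
    sumTo n (λ a → sumTo n (λ k → sumTo n (λ l → (x a * M k a) * (M′ l k * y l))))
      ≈⟨ sumTo-cong n (λ a → sumTo-comm n n _) ⟩
    sumTo n (λ a → sumTo n (λ l → sumTo n (λ k → (x a * M k a) * (M′ l k * y l))))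
      ≈⟨ sumTo-cong n (λ a → trans (sumTo-cong n (λ l → regroup a l)) (sumTo-distribˡ n _ _)) ⟩
    sumTo n (λ a → x a * sumTo n (λ l → sumTo n (λ k → M k a * M′ l k) * y l)) ∎
    where
    regroup : ∀ a l → sumTo n (λ k → (x a * M k a) * (M′ l k * y l)) ≈ x a * (sumTo n (λ k → M k a * M′ l k) * y l)
    regroup a l = begin
      sumTo n (λ k → (x a * M k a) * (M′ l k * y l))
        ≈⟨ sumTo-cong n (λ k → solve 4 (λ x A B y → (x :* A) :* (B :* y) := x :* ((A :* B) :* y)) refl
                                       (x a) (M k a) (M′ l k) (y l)) ⟩
      sumTo n (λ k → x a * ((M k a * M′ l k) * y l))  ≈⟨ sumTo-distribˡ n _ _ ⟩
      x a * sumTo n (λ k → (M k a * M′ l k) * y l)    ≈⟨ *-congˡ (sumTo-distribʳ n _ _) ⟩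
      x a * (sumTo n (λ k → M k a * M′ l k) * y l)    ∎

  sumTo-truncate : ∀ M N (f : ℕ → Carrier) → M ≤ N → (∀ k → M < k → k ≤ N → f k ≈ 0#) →
                   sumTo N f ≈ sumTo M f
  sumTo-truncate M zero    f z≤n f≈0 = refl
  sumTo-truncate M (suc N) f M≤1+N f≈0 with M ℕ.≟ suc N
  ... | yes ≡.refl = refl
  ... | no M≢1+N = trans (+-cong (sumTo-truncate M N f M≤N (λ k M<k k≤N → f≈0 k M<k (ℕₚ.m≤n⇒m≤1+n k≤N)))
                                 (f≈0 (suc N) (s≤s M≤N) ℕₚ.≤-refl))
                         (+-identityʳ _)
    where M≤N = ℕₚ.m<1+n⇒m≤n (ℕₚ.≤∧≢⇒< M≤1+N M≢1+N)

  sumTo-select : ∀ n a (f : ℕ → Carrier) → a ≤ n → (∀ k → k ≤ n → k ≢ a → f k ≈ 0#) → sumTo n f ≈ f a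
  sumTo-select zero .zero f z≤n f≈0 = refl
  sumTo-select (suc n) a f a≤1+n f≈0 with a ℕ.≟ suc n
  ... | yes ≡.refl =
    trans (+-congʳ (sumTo-zero n f (λ k k≤n → f≈0 k (ℕₚ.m≤n⇒m≤1+n k≤n) (ℕₚ.<⇒≢ (s≤s k≤n)))))
          (+-identityˡ _)
  ... | no a≢1+n =
    trans (+-cong (sumTo-select n a f (ℕₚ.m<1+n⇒m≤n (ℕₚ.≤∧≢⇒< a≤1+n a≢1+n))
                                (λ k k≤n → f≈0 k (ℕₚ.m≤n⇒m≤1+n k≤n)))
                  (f≈0 (suc n) ℕₚ.≤-refl (λ e → a≢1+n (≡.sym e))))
          (+-identityʳ _)

  shift : (ℕ → Carrier) → ℕ → Carrier
  shift a zero    = 0#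
  shift a (suc k) = a k

  sumTo-shift : ∀ N (a b : ℕ → Carrier) → a (suc N) ≈ 0# →
                sumTo (suc N) (λ k → shift a k * b k) ≈ sumTo (suc N) (λ k → a k * b (suc k))
  sumTo-shift N a b a[1+N]≈0 = begin
    sumTo (suc N) (λ k → shift a k * b k)        ≈⟨ sumTo-suc N _ ⟩
    0# * b 0 + sumTo N (λ k → a k * b (suc k))   ≈⟨ trans (+-congʳ (zeroˡ _)) (+-identityˡ _) ⟩
    sumTo N (λ k → a k * b (suc k))              ≈⟨ sumTo-truncate N (suc N) _ (ℕₚ.n≤1+n N) last≈0 ⟨
    sumTo (suc N) (λ k → a k * b (suc k))        ∎
    where
    last≈0 : ∀ k → N < k → k ≤ suc N → a k * b (suc k) ≈ 0#
    last≈0 k N<k k≤1+N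
      rewrite ℕₚ.≤-antisym k≤1+N N<k = trans (*-congʳ a[1+N]≈0) (zeroˡ _)

  δ : ℕ → ℕ → Carrier
  δ zero    zero    = 1#
  δ zero    (suc _) = 0#
  δ (suc _) zero    = 0#
  δ (suc a) (suc b) = δ a b

  δ-diag : ∀ a → δ a a ≈ 1#
  δ-diag zero    = refl
  δ-diag (suc a) = δ-diag a

  δ-≢ : ∀ {a b} → a ≢ b → δ a b ≈ 0#
  δ-≢ {zero}  {zero}  a≢b = ⊥-elim (a≢b ≡.refl)
  δ-≢ {zero}  {suc b} a≢b = refl
  δ-≢ {suc a} {zero}  a≢b = refl
  δ-≢ {suc a} {suc b} a≢b = δ-≢ (λ e → a≢b (≡.cong suc e))

  δ-sym : ∀ a b → δ a b ≈ δ b a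
  δ-sym zero    zero    = refl
  δ-sym zero    (suc b) = refl
  δ-sym (suc a) zero    = refl
  δ-sym (suc a) (suc b) = δ-sym a b

  *-δ-diag : ∀ (u : ℕ → Carrier) a b → u a * δ a b ≈ u b * δ a b
  *-δ-diag u a b with a ℕ.≟ b
  ... | yes ≡.refl = refl
  ... | no a≢b     = trans (*-congˡ (δ-≢ a≢b)) (trans (zeroʳ _) (sym (trans (*-congˡ (δ-≢ a≢b)) (zeroʳ _))))

  sumTo-δ : ∀ n a (f : ℕ → Carrier) → a ≤ n → sumTo n (λ k → δ a k * f k) ≈ f a
  sumTo-δ n a f a≤n =
    trans (sumTo-select n a _ a≤n (λ k _ k≢a → trans (*-congʳ (δ-≢ (λ e → k≢a (≡.sym e)))) (zeroˡ _)))
          (trans (*-congʳ (δ-diag a)) (*-identityˡ _))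

  natR-+ : ∀ a b → natR (a ℕ.+ b) ≈ natR a + natR b
  natR-+ zero    b = sym (+-identityˡ _)
  natR-+ (suc a) b = trans (+-congˡ (natR-+ a b)) (sym (+-assoc _ _ _))

  natR-suc-* : ∀ k x → natR (suc k) * x ≈ x + natR k * x
  natR-suc-* k x = trans (distribʳ x 1# (natR k)) (+-congʳ (*-identityˡ x))

  natR-C≡0 : ∀ n k → n C k ≡ 0 → ∀ x → natR (n C k) * x ≈ 0#
  natR-C≡0 n k nCk≡0 x = trans (*-congʳ (reflexive (≡.cong natR nCk≡0))) (zeroˡ x)

  egfMul-congˡ : ∀ {a a′ : EGF} (b : EGF) → (∀ i → a i ≈ a′ i) → ∀ n → egfMul a b n ≈ egfMul a′ b n
  egfMul-congˡ b a≈a′ n = sumTo-cong n (λ i → *-congˡ (*-congʳ (a≈a′ i)))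

  egfMul-congʳ : ∀ (a : EGF) {b b′ : EGF} → (∀ i → b i ≈ b′ i) → ∀ n → egfMul a b n ≈ egfMul a b′ n
  egfMul-congʳ a b≈b′ n = sumTo-cong n (λ i → *-congˡ (*-congˡ (b≈b′ (n ∸ i))))

  egfMul-distribʳ-+ : ∀ (a a′ b : EGF) n →
                      egfMul (λ i → a i + a′ i) b n ≈ egfMul a b n + egfMul a′ b n
  egfMul-distribʳ-+ a a′ b n = trans (sumTo-cong n (λ i →
      solve 4 (λ C x y z → C :* ((x :+ y) :* z) := C :* (x :* z) :+ C :* (y :* z)) refl
              (natR (n C i)) (a i) (a′ i) (b (n ∸ i))))
    (sumTo-distrib-+ n _ _)

  egfMul-distribˡ-+ : ∀ (a b b′ : EGF) n →
                      egfMul a (λ i → b i + b′ i) n ≈ egfMul a b n + egfMul a b′ n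
  egfMul-distribˡ-+ a b b′ n = trans (sumTo-cong n (λ i →
      solve 4 (λ C x y z → C :* (x :* (y :+ z)) := C :* (x :* y) :+ C :* (x :* z)) refl
              (natR (n C i)) (a i) (b (n ∸ i)) (b′ (n ∸ i))))
    (sumTo-distrib-+ n _ _)

  egfMul-scaleˡ : ∀ x (a b : EGF) n → egfMul (λ i → x * a i) b n ≈ x * egfMul a b n
  egfMul-scaleˡ x a b n = trans (sumTo-cong n (λ i →
      solve 4 (λ C x y z → C :* ((x :* y) :* z) := x :* (C :* (y :* z))) refl
              (natR (n C i)) x (a i) (b (n ∸ i))))
    (sumTo-distribˡ n x _)

  egfMul-scaleʳ : ∀ x (a b : EGF) n → egfMul a (λ i → x * b i) n ≈ x * egfMul a b n
  egfMul-scaleʳ x a b n = trans (sumTo-cong n (λ i →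
      solve 4 (λ C x y z → C :* (y :* (x :* z)) := x :* (C :* (y :* z))) refl
              (natR (n C i)) x (a i) (b (n ∸ i))))
    (sumTo-distribˡ n x _)

  egfMul-identityʳ : ∀ (a : EGF) n → egfMul a egfOne n ≈ a n
  egfMul-identityʳ a n = trans (sumTo-select n n _ ℕₚ.≤-refl off-diagonal) diagonal
    where
    off-diagonal : ∀ k → k ≤ n → k ≢ n → natR (n C k) * (a k * egfOne (n ∸ k)) ≈ 0#
    off-diagonal k k≤n k≢n =
      trans (*-congˡ (*-congˡ (reflexive (≡.cong egfOne (ℕₚ.+-∸-assoc 1 (ℕₚ.≤∧≢⇒< k≤n k≢n))))))
            (trans (*-congˡ (zeroʳ _)) (zeroʳ _))
    diagonal : natR (n C n) * (a n * egfOne (n ∸ n)) ≈ a n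
    diagonal rewrite nCn≡1 n | ℕₚ.n∸n≡0 n =
      solve 1 (λ x → (con 1 :+ con 0) :* (x :* con 1) := x) refl (a n)

  egfMul-suc : ∀ (a b : EGF) n →
               egfMul a b (suc n) ≈ egfMul (λ i → a (suc i)) b n + egfMul a (λ i → b (suc i)) n
  egfMul-suc a b n = begin
    egfMul a b (suc n)                                 ≈⟨ sumTo-suc n h ⟩
    h 0 + sumTo n (λ i → h (suc i))                    ≈⟨ +-congˡ (sumTo-cong n pascal) ⟩
    h 0 + sumTo n (λ i → ∂a i + q i)                   ≈⟨ +-congˡ (sumTo-distrib-+ n _ _) ⟩
    h 0 + (egfMul (λ i → a (suc i)) b n + sumTo n q)   ≈⟨ x+yz≈y+xz _ _ _ ⟩
    egfMul (λ i → a (suc i)) b n + (h 0 + sumTo n q)   ≈⟨ +-congˡ ∂b ⟨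
    egfMul (λ i → a (suc i)) b n + egfMul a (λ i → b (suc i)) n ∎
    where
    h : ℕ → Carrier
    h i = natR (suc n C i) * (a i * b (suc n ∸ i))
    ∂a : ℕ → Carrier
    ∂a i = natR (n C i) * (a (suc i) * b (n ∸ i))
    q : ℕ → Carrier
    q i = natR (n C suc i) * (a (suc i) * b (n ∸ i))
    g : ℕ → Carrier
    g i = natR (n C i) * (a i * b (suc (n ∸ i)))
    pascal : ∀ i → h (suc i) ≈ ∂a i + q i
    pascal i = trans (*-congʳ (trans (reflexive (≡.cong natR (≡.sym (nCk+nC[k+1]≡[n+1]C[k+1] n i))))
                                     (natR-+ (n C i) (n C suc i))))
                     (distribʳ _ _ _)
    g-suc : ∀ i → i ≤ n → g (suc i) ≈ q i
    g-suc i i≤n with i ℕ.≟ n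
    ... | yes ≡.refl = trans (natR-C≡0 n (suc n) n+1Cn≡0 _) (sym (natR-C≡0 n (suc n) n+1Cn≡0 _))
      where n+1Cn≡0 = k>n⇒nCk≡0 (ℕₚ.n<1+n n)
    ... | no i≢n     = *-congˡ (*-congˡ (reflexive (≡.cong b (≡.sym (ℕₚ.+-∸-assoc 1 (ℕₚ.≤∧≢⇒< i≤n i≢n))))))
    ∂b : egfMul a (λ i → b (suc i)) n ≈ h 0 + sumTo n q
    ∂b = begin
      sumTo n g
        ≈⟨ sumTo-truncate n (suc n) g (ℕₚ.n≤1+n n) (λ k n<k _ → natR-C≡0 n k (k>n⇒nCk≡0 n<k) _) ⟨
      sumTo (suc n) g                  ≈⟨ sumTo-suc n g ⟩
      g 0 + sumTo n (λ i → g (suc i))  ≈⟨ +-congˡ (sumTo-cong≤ n g-suc) ⟩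
      h 0 + sumTo n q                  ∎

  egfMul-euler : ∀ (a b : EGF) n →
                 natR n * egfMul a b n ≈ egfMul (λ i → natR i * a i) b n + egfMul a (λ i → natR i * b i) n
  egfMul-euler a b n = begin
    natR n * egfMul a b n                                     ≈⟨ sumTo-distribˡ n _ _ ⟨
    sumTo n (λ i → natR n * (natR (n C i) * (a i * b (n ∸ i)))) ≈⟨ sumTo-cong≤ n split ⟩
    sumTo n (λ i → natR (n C i) * ((natR i * a i) * b (n ∸ i)) + natR (n C i) * (a i * (natR (n ∸ i) * b (n ∸ i))))
                                                              ≈⟨ sumTo-distrib-+ n _ _ ⟩
    egfMul (λ i → natR i * a i) b n + egfMul a (λ i → natR i * b i) n ∎
    where
    split : ∀ i → i ≤ n → natR n * (natR (n C i) * (a i * b (n ∸ i))) ≈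
            natR (n C i) * ((natR i * a i) * b (n ∸ i)) + natR (n C i) * (a i * (natR (n ∸ i) * b (n ∸ i)))
    split i i≤n = begin
      natR n * (natR (n C i) * (a i * b (n ∸ i)))
        ≈⟨ *-congʳ (reflexive (≡.cong natR (ℕₚ.m+[n∸m]≡n i≤n))) ⟨
      natR (i ℕ.+ (n ∸ i)) * (natR (n C i) * (a i * b (n ∸ i)))     ≈⟨ *-congʳ (natR-+ i (n ∸ i)) ⟩
      (natR i + natR (n ∸ i)) * (natR (n C i) * (a i * b (n ∸ i)))
        ≈⟨ solve 5 (λ I J C x y → (I :+ J) :* (C :* (x :* y)) := C :* ((I :* x) :* y) :+ C :* (x :* (J :* y))) refl
                   (natR i) (natR (n ∸ i)) (natR (n C i)) (a i) (b (n ∸ i)) ⟩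
      natR (n C i) * ((natR i * a i) * b (n ∸ i)) + natR (n C i) * (a i * (natR (n ∸ i) * b (n ∸ i))) ∎

  -- the operator (1 + c t) d/dt on exponential generating functions
  D : Carrier → EGF → EGF
  D c u n = u (suc n) + c * (natR n * u n)

  D-leibniz : ∀ c (a b : EGF) n → D c (egfMul a b) n ≈ egfMul (D c a) b n + egfMul a (D c b) n
  D-leibniz c a b n = begin
    D c (egfMul a b) n                           ≈⟨ +-cong (egfMul-suc a b n) (*-congˡ (egfMul-euler a b n)) ⟩
    (∂a·b + a·∂b) + c * (θa·b + a·θb)
      ≈⟨ solve 5 (λ c x y z w → (x :+ y) :+ c :* (z :+ w) := (x :+ c :* z) :+ (y :+ c :* w)) refl
                 c ∂a·b a·∂b θa·b a·θb ⟩
    (∂a·b + c * θa·b) + (a·∂b + c * a·θb)        ≈⟨ +-cong Da·b a·Db ⟨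
    egfMul (D c a) b n + egfMul a (D c b) n      ∎
    where
    ∂a·b = egfMul (λ i → a (suc i)) b n
    a·∂b = egfMul a (λ i → b (suc i)) n
    θa·b = egfMul (λ i → natR i * a i) b n
    a·θb = egfMul a (λ i → natR i * b i) n
    Da·b : egfMul (D c a) b n ≈ ∂a·b + c * θa·b
    Da·b = trans (egfMul-distribʳ-+ (λ i → a (suc i)) (λ i → c * (natR i * a i)) b n)
                 (+-congˡ (egfMul-scaleˡ c (λ i → natR i * a i) b n))
    a·Db : egfMul a (D c b) n ≈ a·∂b + c * a·θb
    a·Db = trans (egfMul-distribˡ-+ a (λ i → b (suc i)) (λ i → c * (natR i * b i)) n)
                 (+-congˡ (egfMul-scaleʳ c a (λ i → natR i * b i) n))

  natR*egfOne≈0 : ∀ n → natR n * egfOne n ≈ 0#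
  natR*egfOne≈0 zero    = zeroˡ _
  natR*egfOne≈0 (suc n) = zeroʳ _

  natR-*-cong-suc : ∀ (x y : ℕ → Carrier) k → (∀ l → x (suc l) ≈ y (suc l)) → natR k * x k ≈ natR k * y k
  natR-*-cong-suc x y zero    x≈y = trans (zeroˡ _) (sym (zeroˡ _))
  natR-*-cong-suc x y (suc k) x≈y = *-congˡ (x≈y k)

  module Sheffer (c α β : Carrier) (g f : EGF)
                 (D-g : ∀ n → D c g n ≈ α * g n)
                 (D-f : ∀ n → D c f n ≈ egfOne n + β * f n) where

    D-egfPow : ∀ k n → D c (egfPow f k) n ≈ natR k * (β * egfPow f k n) + natR k * shift (λ l → egfPow f l n) k
    D-egfPow zero n = begin
      egfOne (suc n) + c * (natR n * egfOne n)  ≈⟨ +-congˡ (trans (*-congˡ (natR*egfOne≈0 n)) (zeroʳ c)) ⟩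
      0# + 0#                                   ≈⟨ +-cong (zeroˡ _) (zeroˡ _) ⟨
      0# * (β * egfOne n) + 0# * 0#             ∎
    D-egfPow (suc k) n = begin
      D c (egfMul F f) n                                   ≈⟨ D-leibniz c F f n ⟩
      egfMul (D c F) f n + egfMul F (D c f) n              ≈⟨ +-cong (egfMul-congˡ f (D-egfPow k) n)
                                                                     (egfMul-congʳ F D-f n) ⟩
      egfMul (λ i → K * (β * F i) + K * shift (λ l → egfPow f l i) k) f n + egfMul F (λ i → egfOne i + β * f i) n
                                                           ≈⟨ +-cong D-F·f F·D-f ⟩
      (K * (β * W) + K * F n) + (F n + β * W)
        ≈⟨ solve 4 (λ K b w v → (K :* (b :* w) :+ K :* v) :+ (v :+ b :* w) := (b :* w :+ K :* (b :* w)) :+ (v :+ K :* v))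
                   refl K β W (F n) ⟩
      (β * W + K * (β * W)) + (F n + K * F n)              ≈⟨ +-cong (natR-suc-* k _) (natR-suc-* k _) ⟨
      natR (suc k) * (β * W) + natR (suc k) * F n          ∎
      where
      F = egfPow f k
      K = natR k
      W = egfMul F f n
      D-F·f : egfMul (λ i → K * (β * F i) + K * shift (λ l → egfPow f l i) k) f n ≈ K * (β * W) + K * F n
      D-F·f = trans (egfMul-distribʳ-+ (λ i → K * (β * F i)) (λ i → K * shift (λ l → egfPow f l i) k) f n)
                    (+-cong (trans (egfMul-scaleˡ K (λ i → β * F i) f n) (*-congˡ (egfMul-scaleˡ β F f n)))
                            (trans (egfMul-scaleˡ K (λ i → shift (λ l → egfPow f l i) k) f n)
                                   (natR-*-cong-suc (λ l → egfMul (λ i → shift (λ l′ → egfPow f l′ i) l) f n)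
                                                    (λ l → egfPow f l n) k (λ _ → refl))))
      F·D-f : egfMul F (λ i → egfOne i + β * f i) n ≈ F n + β * W
      F·D-f = trans (egfMul-distribˡ-+ F egfOne (λ i → β * f i) n)
                    (+-cong (egfMul-identityʳ F n) (egfMul-scaleʳ β F f n))

    U : ℕ → EGF
    U k = egfMul g (egfPow f k)

    D-U : ∀ k n → D c (U k) n ≈ (α + natR k * β) * U k n + natR k * shift (λ l → U l n) k
    D-U k n = begin
      D c (U k) n                                          ≈⟨ D-leibniz c g F n ⟩
      egfMul (D c g) F n + egfMul g (D c F) n              ≈⟨ +-cong (egfMul-congˡ F D-g n)
                                                                     (egfMul-congʳ g (D-egfPow k) n) ⟩
      egfMul (λ i → α * g i) F n + egfMul g (λ i → K * (β * F i) + K * shift (λ l → egfPow f l i) k) n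
                                                           ≈⟨ +-cong (egfMul-scaleˡ α g F n) g·D-F ⟩
      α * U k n + (K * (β * U k n) + K * shift (λ l → U l n) k)
        ≈⟨ solve 5 (λ a K b u w → a :* u :+ (K :* (b :* u) :+ w) := (a :+ K :* b) :* u :+ w) refl
                   α K β (U k n) (K * shift (λ l → U l n) k) ⟩
      (α + K * β) * U k n + K * shift (λ l → U l n) k      ∎
      where
      F = egfPow f k
      K = natR k
      g·D-F : egfMul g (λ i → K * (β * F i) + K * shift (λ l → egfPow f l i) k) n ≈
              K * (β * U k n) + K * shift (λ l → U l n) k
      g·D-F = trans (egfMul-distribˡ-+ g (λ i → K * (β * F i)) (λ i → K * shift (λ l → egfPow f l i) k) n)
                    (+-cong (trans (egfMul-scaleʳ K g (λ i → β * F i) n) (*-congˡ (egfMul-scaleʳ β g F n)))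
                            (trans (egfMul-scaleʳ K g (λ i → shift (λ l → egfPow f l i) k) n)
                                   (natR-*-cong-suc (λ l → egfMul g (λ i → shift (λ l′ → egfPow f l′ i) l) n)
                                                    (λ l → shift (λ l′ → U l′ n) l) k (λ _ → refl))))

  D-fall : ∀ x μ n → D μ (fall x μ) n ≈ x * fall x μ n
  D-fall x μ n = begin
    F * (x - N * μ) + μ * (N * F)
      ≈⟨ solve 5 (λ F x m′ N μ → F :* (x :+ m′) :+ μ :* (N :* F) := x :* F :+ F :* (m′ :+ N :* μ)) refl
                 F x (- (N * μ)) N μ ⟩
    x * F + F * (- (N * μ) + N * μ)  ≈⟨ +-congˡ (trans (*-congˡ (-‿inverseˡ (N * μ))) (zeroʳ F)) ⟩
    x * F + 0#                       ≈⟨ +-identityʳ _ ⟩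
    x * F                            ∎
    where
    F = fall x μ n
    N = natR n

  fall-1 : ∀ x μ → fall x μ 1 ≈ x
  fall-1 x μ = trans (*-identityˡ _) (trans (+-congˡ (trans (-‿cong (zeroˡ μ)) -0#≈0#)) (+-identityʳ x))

  -- f = (e_μ^ν(t) − 1)/ν, so that D f = (1 + μt) f′ = e_μ^ν(t) = 1 + ν f
  D-log : ∀ ν μ (f : EGF) → ν * inv ν ≈ 1# → f 0 ≈ 0# → (∀ j → f (suc j) ≈ inv ν * fall ν μ (suc j)) →
          ∀ n → D μ f n ≈ egfOne n + ν * f n
  D-log ν μ f ν*ν⁻¹≈1 f0≈0 f-suc zero = begin
    f 1 + μ * (0# * f 0)  ≈⟨ +-cong (trans (f-suc 0) (*-congˡ (fall-1 ν μ))) (trans (*-congˡ (zeroˡ _)) (zeroʳ μ)) ⟩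
    inv ν * ν + 0#        ≈⟨ trans (+-identityʳ _) (trans (*-comm _ _) ν*ν⁻¹≈1) ⟩
    1#                    ≈⟨ +-identityʳ 1# ⟨
    1# + 0#               ≈⟨ +-congˡ (trans (*-congˡ f0≈0) (zeroʳ ν)) ⟨
    1# + ν * f 0          ∎
  D-log ν μ f ν*ν⁻¹≈1 f0≈0 f-suc (suc n) = begin
    f (suc (suc n)) + μ * (N * f (suc n))                ≈⟨ +-cong (f-suc (suc n)) (*-congˡ (*-congˡ (f-suc n))) ⟩
    inv ν * fall ν μ (suc (suc n)) + μ * (N * (inv ν * F))
      ≈⟨ solve 5 (λ i G μ N F → i :* G :+ μ :* (N :* (i :* F)) := i :* (G :+ μ :* (N :* F))) refl
                 (inv ν) (fall ν μ (suc (suc n))) μ N F ⟩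
    inv ν * D μ (fall ν μ) (suc n)                       ≈⟨ *-congˡ (D-fall ν μ (suc n)) ⟩
    inv ν * (ν * F)                                      ≈⟨ x*yz≈y*xz _ _ _ ⟩
    ν * (inv ν * F)                                      ≈⟨ *-congˡ (f-suc n) ⟨
    ν * f (suc n)                                        ≈⟨ +-identityˡ _ ⟨
    0# + ν * f (suc n)                                   ∎
    where
    N = natR (suc n)
    F = fall ν μ (suc n)

  sumTo-*δ : ∀ n (p : ℕ → Carrier) → (∀ i → n < i → p i ≈ 0#) → ∀ i → sumTo n (λ j → p j * δ j i) ≈ p i
  sumTo-*δ n p p-deg i with i ℕₚ.≤? n
  ... | yes i≤n = trans (sumTo-cong n (λ j → trans (*-comm _ _) (*-congʳ (δ-sym j i)))) (sumTo-δ n i p i≤n)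
  ... | no  i≰n = trans (sumTo-zero n _ (λ j j≤n → trans (*-congˡ (δ-≢ {j} {i} (λ { ≡.refl → i≰n j≤n }))) (zeroʳ _)))
                        (sym (p-deg i (ℕₚ.≰⇒> i≰n)))

  module Field (x*x⁻¹≈1 : ∀ x → ¬ (x ≈ 0#) → x * inv x ≈ 1#)
               (natR-suc≉0 : ∀ n → ¬ (natR (suc n) ≈ 0#)) where

    1≉0 : ¬ (1# ≈ 0#)
    1≉0 1≈0 = natR-suc≉0 0 (trans (+-congʳ 1≈0) (+-identityʳ 0#))

    natR≉0 : ∀ m → 1 ≤ m → ¬ (natR m ≈ 0#)
    natR≉0 (suc m) _ = natR-suc≉0 m

    *-≉0 : ∀ {a b} → ¬ (a ≈ 0#) → ¬ (b ≈ 0#) → ¬ (a * b ≈ 0#)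
    *-≉0 {a} {b} a≉0 b≉0 a*b≈0 = b≉0 (begin
      b                ≈⟨ *-identityˡ b ⟨
      1# * b           ≈⟨ *-congʳ (x*x⁻¹≈1 a a≉0) ⟨
      (a * inv a) * b  ≈⟨ solve 3 (λ a i b → (a :* i) :* b := i :* (a :* b)) refl a (inv a) b ⟩
      inv a * (a * b)  ≈⟨ *-congˡ a*b≈0 ⟩
      inv a * 0#       ≈⟨ zeroʳ _ ⟩
      0#               ∎)

    factR≉0 : ∀ k → ¬ (factR k ≈ 0#)
    factR≉0 zero    = 1≉0
    factR≉0 (suc k) = *-≉0 (natR-suc≉0 k) (factR≉0 k)

    inv-1 : inv 1# ≈ 1#
    inv-1 = trans (sym (*-identityˡ (inv 1#))) (x*x⁻¹≈1 1# 1≉0)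

    inv-factR-suc : ∀ k → inv (factR (suc k)) * natR (suc k) ≈ inv (factR k)
    inv-factR-suc k = begin
      X * N                  ≈⟨ *-identityʳ _ ⟨
      X * N * 1#             ≈⟨ *-congˡ (x*x⁻¹≈1 F (factR≉0 k)) ⟨
      X * N * (F * Y)        ≈⟨ solve 4 (λ X N F Y → X :* N :* (F :* Y) := ((N :* F) :* X) :* Y) refl X N F Y ⟩
      ((N * F) * X) * Y      ≈⟨ *-congʳ (x*x⁻¹≈1 (N * F) (factR≉0 (suc k))) ⟩
      1# * Y                 ≈⟨ *-identityˡ Y ⟩
      Y                      ∎
      where
      N = natR (suc k)
      F = factR k
      X = inv (factR (suc k))
      Y = inv F

    module Normalised (c α β : Carrier) (g f : EGF)
                      (D-g : ∀ n → D c g n ≈ α * g n)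
                      (D-f : ∀ n → D c f n ≈ egfOne n + β * f n)
                      (g0≈1 : g 0 ≈ 1#) (f0≈0 : f 0 ≈ 0#) where
      open Sheffer c α β g f D-g D-f public

      N : ℕ → EGF
      N k j = inv (factR k) * U k j

      D-N : ∀ k j → D c (N k) j ≈ (α + natR k * β) * N k j + shift (λ l → N l j) k
      D-N k j = begin
        I * U k (suc j) + c * (natR j * (I * U k j))
          ≈⟨ solve 5 (λ I u v c J → I :* u :+ c :* (J :* (I :* v)) := I :* (u :+ c :* (J :* v))) refl
                     I (U k (suc j)) (U k j) c (natR j) ⟩
        I * D c (U k) j                                      ≈⟨ *-congˡ (D-U k j) ⟩
        I * ((α + natR k * β) * U k j + natR k * shift (λ l → U l j) k)
          ≈⟨ solve 4 (λ I a u w → I :* (a :* u :+ w) := a :* (I :* u) :+ I :* w) refl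
                     I (α + natR k * β) (U k j) (natR k * shift (λ l → U l j) k) ⟩
        (α + natR k * β) * N k j + I * (natR k * shift (λ l → U l j) k)  ≈⟨ +-congˡ (normalise k) ⟩
        (α + natR k * β) * N k j + shift (λ l → N l j) k     ∎
        where
        I = inv (factR k)
        normalise : ∀ k → inv (factR k) * (natR k * shift (λ l → U l j) k) ≈ shift (λ l → N l j) k
        normalise zero    = trans (*-congˡ (zeroˡ _)) (zeroʳ _)
        normalise (suc k) = trans (sym (*-assoc _ _ _)) (*-congʳ (inv-factR-suc k))

      N-zero : ∀ k → N k 0 ≈ δ k 0
      N-zero zero    = trans (*-cong inv-1 (egfMul-identityʳ g 0)) (trans (*-identityˡ _) g0≈1)
      N-zero (suc k) = trans (*-congˡ (trans (*-congˡ (trans (*-congˡ f^[1+k]0≈0) (zeroʳ _))) (zeroʳ _))) (zeroʳ _)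
        where
        f^[1+k]0≈0 : egfPow f (suc k) 0 ≈ 0#
        f^[1+k]0≈0 = trans (*-congˡ (trans (*-congˡ f0≈0) (zeroʳ _))) (zeroʳ _)

      N-vanish : ∀ j k → j < k → N k j ≈ 0#
      N-vanish zero    (suc k) _          = N-zero (suc k)
      N-vanish (suc j) (suc k) (s≤s j<k) = begin
        N (suc k) (suc j)                                      ≈⟨ +-identityʳ _ ⟨
        N (suc k) (suc j) + 0#
          ≈⟨ +-congˡ (trans (*-congˡ (*-congˡ Nj≈0)) (trans (*-congˡ (zeroʳ _)) (zeroʳ c))) ⟨
        D c (N (suc k)) j                                      ≈⟨ D-N (suc k) j ⟩
        (α + natR (suc k) * β) * N (suc k) j + N k j           ≈⟨ +-cong (trans (*-congˡ Nj≈0) (zeroʳ _)) (N-vanish j k j<k) ⟩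
        0# + 0#                                                ≈⟨ +-identityʳ _ ⟩
        0#                                                     ∎
        where Nj≈0 = N-vanish j (suc k) (ℕₚ.m<n⇒m<1+n j<k)

  module Coordinates (lam : Carrier) (m : ℕ) where
    open Params lam m

    S-vanish : ∀ j a → j < a → S j a ≈ 0#
    S-vanish zero    (suc a) _          = refl
    S-vanish (suc j) (suc a) (s≤s j<a) =
      trans (+-cong (S-vanish j a j<a) (trans (*-congˡ (S-vanish j (suc a) (ℕₚ.m<n⇒m<1+n j<a))) (zeroʳ _)))
            (+-identityʳ 0#)

    sumTo-S-extend : ∀ j n (h : ℕ → Carrier) → j ≤ n → sumTo n (λ a → S j a * h a) ≈ sumTo j (λ a → S j a * h a)
    sumTo-S-extend j n h j≤n = sumTo-truncate j n _ j≤n (λ a j<a _ → trans (*-congʳ (S-vanish j a j<a)) (zeroˡ _))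

    x*polyFall : ∀ a i → polyMulX (polyFall lam a) i ≈ polyFall lam (suc a) i + (natR a * lam) * polyFall lam a i
    x*polyFall a i = begin
      x                 ≈⟨ +-identityʳ x ⟨
      x + 0#            ≈⟨ +-congˡ (trans (*-congʳ (-‿inverseˡ y)) (zeroˡ z)) ⟨
      x + (- y + y) * z ≈⟨ +-congˡ (distribʳ z (- y) y) ⟩
      x + (- y * z + y * z) ≈⟨ +-assoc _ _ _ ⟨
      (x + - y * z) + y * z ∎
      where
      x = polyMulX (polyFall lam a) i
      y = natR a * lam
      z = polyFall lam a i

    sumTo-S-suc-polyFall : ∀ j i → sumTo (suc j) (λ a → S (suc j) a * polyFall lam a i) ≈
                                   sumTo j (λ a → S j a * polyMulX (polyFall lam a) i)
    sumTo-S-suc-polyFall j i = begin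
      sumTo (suc j) (λ a → S (suc j) a * F a)                              ≈⟨ sumTo-suc j _ ⟩
      0# * F 0 + sumTo j (λ a → S (suc j) (suc a) * F (suc a))             ≈⟨ trans (+-congʳ (zeroˡ _)) (+-identityˡ _) ⟩
      sumTo j (λ a → (S j a + (natR (suc a) * lam) * S j (suc a)) * F (suc a))  ≈⟨ sumTo-cong j (λ a → distribʳ _ _ _) ⟩
      sumTo j (λ a → S j a * F (suc a) + t (suc a))                        ≈⟨ sumTo-distrib-+ j _ _ ⟩
      sumTo j (λ a → S j a * F (suc a)) + sumTo j (λ a → t (suc a))        ≈⟨ +-congˡ t-reindex ⟩
      sumTo j (λ a → S j a * F (suc a)) + sumTo j t                        ≈⟨ sumTo-distrib-+ j _ _ ⟨
      sumTo j (λ a → S j a * F (suc a) + t a)                              ≈⟨ sumTo-cong j regroup ⟩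
      sumTo j (λ a → S j a * polyMulX (polyFall lam a) i)                  ∎
      where
      F : ℕ → Carrier
      F a = polyFall lam a i
      t : ℕ → Carrier
      t a = ((natR a * lam) * S j a) * F a
      t-reindex : sumTo j (λ a → t (suc a)) ≈ sumTo j t
      t-reindex = begin
        sumTo j (λ a → t (suc a))        ≈⟨ +-identityˡ _ ⟨
        0# + sumTo j (λ a → t (suc a))   ≈⟨ +-congʳ (trans (*-congʳ (trans (*-congʳ (zeroˡ lam)) (zeroˡ _))) (zeroˡ _)) ⟨
        t 0 + sumTo j (λ a → t (suc a))  ≈⟨ sumTo-suc j t ⟨
        sumTo (suc j) t                  ≈⟨ sumTo-truncate j (suc j) t (ℕₚ.n≤1+n j)
                                              (λ k j<k _ → trans (*-congʳ (trans (*-congˡ (S-vanish j k j<k)) (zeroʳ _))) (zeroˡ _)) ⟩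
        sumTo j t                        ∎
      regroup : ∀ a → S j a * F (suc a) + t a ≈ S j a * polyMulX (polyFall lam a) i
      regroup a = trans (solve 4 (λ s f K g → s :* f :+ (K :* s) :* g := s :* (f :+ K :* g)) refl
                                 (S j a) (F (suc a)) (natR a * lam) (F a))
                        (*-congˡ (sym (x*polyFall a i)))

    sumTo-S-polyFall : ∀ j i → sumTo j (λ a → S j a * polyFall lam a i) ≈ δ j i
    sumTo-S-polyFall zero    zero    = *-identityˡ _
    sumTo-S-polyFall zero    (suc i) = *-identityˡ _
    sumTo-S-polyFall (suc j) zero    = trans (sumTo-S-suc-polyFall j zero) (sumTo-zero j _ (λ a _ → zeroʳ _))
    sumTo-S-polyFall (suc j) (suc i) = trans (sumTo-S-suc-polyFall j (suc i)) (sumTo-S-polyFall j i)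

    coord : ℕ → Poly → ℕ → Carrier
    coord n p a = sumTo n (λ j → p j * S j a)

    pairing-coord : ∀ n (e : EGF) (p : Poly) → pairing n e p ≈ sumTo n (λ a → coord n p a * e a)
    pairing-coord n e p = begin
      sumTo n (λ j → p j * sumTo j (λ a → S j a * e a))
        ≈⟨ sumTo-cong≤ n (λ j j≤n → *-congˡ (sumTo-S-extend j n e j≤n)) ⟨
      sumTo n (λ j → p j * sumTo n (λ a → S j a * e a))    ≈⟨ sumTo-cong n (λ j → trans (sym (sumTo-distribˡ n _ _))
                                                                                       (sumTo-cong n (λ a → sym (*-assoc _ _ _)))) ⟩
      sumTo n (λ j → sumTo n (λ a → (p j * S j a) * e a))  ≈⟨ sumTo-comm n n _ ⟩
      sumTo n (λ a → sumTo n (λ j → (p j * S j a) * e a))  ≈⟨ sumTo-cong n (λ a → sumTo-distribʳ n _ _) ⟩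
      sumTo n (λ a → coord n p a * e a)                    ∎

    coord-expansion : ∀ n (p : Poly) → (∀ i → n < i → p i ≈ 0#) →
                      ∀ i → sumTo n (λ a → coord n p a * polyFall lam a i) ≈ p i
    coord-expansion n p p-deg i = begin
      sumTo n (λ a → coord n p a * polyFall lam a i)  ≈⟨ pairing-coord n (λ a → polyFall lam a i) p ⟨
      pairing n (λ a → polyFall lam a i) p            ≈⟨ sumTo-cong n (λ j → *-congˡ (sumTo-S-polyFall j i)) ⟩
      sumTo n (λ j → p j * δ j i)                     ≈⟨ sumTo-*δ n p p-deg i ⟩
      p i                                             ∎

  module Inverse (μ ν α α′ : Carrier) (α+α′≈0 : α + α′ ≈ 0#) (A B : ℕ → EGF)
                 (D-A : ∀ k j → D μ (A k) j ≈ (α + natR k * ν) * A k j + shift (λ l → A l j) k)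
                 (D-B : ∀ i k → D ν (B i) k ≈ (α′ + natR i * μ) * B i k + shift (λ l → B l k) i)
                 (A-zero : ∀ k → A k 0 ≈ δ k 0) (B-zero : ∀ i → B i 0 ≈ δ i 0)
                 (A-vanish : ∀ j k → j < k → A k j ≈ 0#) where

    P : ℕ → ℕ → ℕ → Carrier
    P N j i = sumTo N (λ k → A k j * B i k)

    -- The kν-terms of D-A and the index shift of A reassemble into D ν (B i), so D-B applies.
    P-suc : ∀ N j i → j ≤ N →
            P (suc N) (suc j) i + (μ * natR j) * P (suc N) j i ≈
            (μ * natR i) * P (suc N) j i + sumTo (suc N) (λ k → A k j * shift (λ l → B l k) i)
    P-suc N j i j≤N = begin
      P N₁ (suc j) i + (μ * natR j) * P N₁ j i                   ≈⟨ expand-D-A ⟩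
      α * P N₁ j i + (sumTo N₁ (λ k → shift a k * b k) + sumTo N₁ (λ k → a k * (ν * (natR k * b k))))
        ≈⟨ +-congˡ (+-congʳ (sumTo-shift N a b (A-vanish j (suc N) (s≤s j≤N)))) ⟩
      α * P N₁ j i + (sumTo N₁ (λ k → a k * b (suc k)) + sumTo N₁ (λ k → a k * (ν * (natR k * b k))))
                                                                 ≈⟨ +-congˡ expand-D-B ⟩
      α * P N₁ j i + ((α′ + natR i * μ) * P N₁ j i + Q)
        ≈⟨ solve 6 (λ a a′ I μ P Q → a :* P :+ ((a′ :+ I :* μ) :* P :+ Q) := (a :+ a′) :* P :+ ((μ :* I) :* P :+ Q))
                   refl α α′ (natR i) μ (P N₁ j i) Q ⟩
      (α + α′) * P N₁ j i + ((μ * natR i) * P N₁ j i + Q)        ≈⟨ +-congʳ (trans (*-congʳ α+α′≈0) (zeroˡ _)) ⟩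
      0# + ((μ * natR i) * P N₁ j i + Q)                         ≈⟨ +-identityˡ _ ⟩
      (μ * natR i) * P N₁ j i + Q                                ∎
      where
      N₁ = suc N
      a b b′ : ℕ → Carrier
      a k = A k j
      b k = B i k
      b′ k = shift (λ l → B l k) i
      Q = sumTo N₁ (λ k → a k * b′ k)
      expand-D-A : P N₁ (suc j) i + (μ * natR j) * P N₁ j i ≈
                   α * P N₁ j i + (sumTo N₁ (λ k → shift a k * b k) + sumTo N₁ (λ k → a k * (ν * (natR k * b k))))
      expand-D-A = begin
        P N₁ (suc j) i + (μ * natR j) * P N₁ j i                  ≈⟨ +-congˡ (sumTo-distribˡ N₁ _ _) ⟨
        P N₁ (suc j) i + sumTo N₁ (λ k → (μ * natR j) * (a k * b k))  ≈⟨ sumTo-distrib-+ N₁ _ _ ⟨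
        sumTo N₁ (λ k → A k (suc j) * b k + (μ * natR j) * (a k * b k))
          ≈⟨ sumTo-cong N₁ (λ k → solve 5 (λ a′ b μ J a → a′ :* b :+ (μ :* J) :* (a :* b) := (a′ :+ μ :* (J :* a)) :* b)
                                          refl (A k (suc j)) (b k) μ (natR j) (a k)) ⟩
        sumTo N₁ (λ k → D μ (A k) j * b k)                        ≈⟨ sumTo-cong N₁ (λ k → *-congʳ (D-A k j)) ⟩
        sumTo N₁ (λ k → ((α + natR k * ν) * a k + shift a k) * b k)
          ≈⟨ sumTo-cong N₁ (λ k → solve 6 (λ α K ν a s b → ((α :+ K :* ν) :* a :+ s) :* b :=
                                                       α :* (a :* b) :+ (s :* b :+ a :* (ν :* (K :* b))))
                                          refl α (natR k) ν (a k) (shift a k) (b k)) ⟩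
        sumTo N₁ (λ k → α * (a k * b k) + (shift a k * b k + a k * (ν * (natR k * b k))))
          ≈⟨ trans (sumTo-distrib-+ N₁ _ _) (+-cong (sumTo-distribˡ N₁ α _) (sumTo-distrib-+ N₁ _ _)) ⟩
        α * P N₁ j i + (sumTo N₁ (λ k → shift a k * b k) + sumTo N₁ (λ k → a k * (ν * (natR k * b k)))) ∎
      expand-D-B : sumTo N₁ (λ k → a k * b (suc k)) + sumTo N₁ (λ k → a k * (ν * (natR k * b k))) ≈
                   (α′ + natR i * μ) * P N₁ j i + Q
      expand-D-B = begin
        sumTo N₁ (λ k → a k * b (suc k)) + sumTo N₁ (λ k → a k * (ν * (natR k * b k)))
          ≈⟨ trans (sumTo-cong N₁ (λ k → distribˡ (a k) _ _)) (sumTo-distrib-+ N₁ _ _) ⟨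
        sumTo N₁ (λ k → a k * D ν (B i) k)                        ≈⟨ sumTo-cong N₁ (λ k → *-congˡ (D-B i k)) ⟩
        sumTo N₁ (λ k → a k * ((α′ + natR i * μ) * b k + b′ k))
          ≈⟨ sumTo-cong N₁ (λ k → trans (distribˡ (a k) _ _) (+-congʳ (x*yz≈y*xz _ _ _))) ⟩
        sumTo N₁ (λ k → (α′ + natR i * μ) * (a k * b k) + a k * b′ k)
          ≈⟨ trans (sumTo-distrib-+ N₁ _ _) (+-congʳ (sumTo-distribˡ N₁ _ _)) ⟩
        (α′ + natR i * μ) * P N₁ j i + Q                          ∎

    inverse : ∀ N j → j ≤ N → ∀ i → P N j i ≈ δ j i
    inverse N zero _ i = begin
      P N 0 i        ≈⟨ sumTo-select N 0 _ z≤n off-diagonal ⟩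
      A 0 0 * B i 0  ≈⟨ *-cong (A-zero 0) (B-zero i) ⟩
      1# * δ i 0     ≈⟨ *-identityˡ _ ⟩
      δ i 0          ≈⟨ δ-sym i 0 ⟩
      δ 0 i          ∎
      where
      off-diagonal : ∀ k → k ≤ N → k ≢ 0 → A k 0 * B i k ≈ 0#
      off-diagonal zero    _ 0≢0 = ⊥-elim (0≢0 ≡.refl)
      off-diagonal (suc k) _ _   = trans (*-congʳ (A-zero (suc k))) (zeroˡ _)
    inverse (suc N) (suc j) (s≤s j≤N) i = +-cancelʳ t _ _ (begin
      P (suc N) (suc j) i + t                                ≈⟨ +-congˡ (*-congˡ (IH i)) ⟨
      P (suc N) (suc j) i + (μ * natR j) * P (suc N) j i     ≈⟨ P-suc N j i j≤N ⟩
      (μ * natR i) * P (suc N) j i + sumTo (suc N) (λ k → A k j * shift (λ l → B l k) i)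
        ≈⟨ +-cong (trans (*-congˡ (IH i)) (sym (*-δ-diag (λ x → μ * natR x) j i))) (lowered i) ⟩
      t + δ (suc j) i                                        ≈⟨ +-comm _ _ ⟩
      δ (suc j) i + t                                        ∎)
      where
      IH = inverse (suc N) j (ℕₚ.m≤n⇒m≤1+n j≤N)
      t = (μ * natR j) * δ j i
      lowered : ∀ i → sumTo (suc N) (λ k → A k j * shift (λ l → B l k) i) ≈ δ (suc j) i
      lowered zero    = sumTo-zero (suc N) _ (λ _ _ → zeroʳ _)
      lowered (suc i) = IH i

    inverse-apply : ∀ n a → a ≤ n → (y : ℕ → Carrier) → sumTo n (λ l → P n a l * y l) ≈ y a
    inverse-apply n a a≤n y = trans (sumTo-cong n (λ l → *-congʳ (inverse n a a≤n l))) (sumTo-δ n a y a≤n)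

  module Families (x*x⁻¹≈1 : ∀ x → ¬ (x ≈ 0#) → x * inv x ≈ 1#)
                  (natR-suc≉0 : ∀ n → ¬ (natR (suc n) ≈ 0#))
                  (lam : Carrier) (lam≉0 : ¬ (lam ≈ 0#)) (m : ℕ) (1≤m : 1 ≤ m) where
    open Field x*x⁻¹≈1 natR-suc≉0
    open Params lam m
    open Coordinates lam m

    -- A k is (1+mt)^{-1/m} G(t)^k/k! with G(t) = (e_m^λ(t) − 1)/λ, and B k is e_λ(t) F(t)^k/k!
    -- with F(t) = (e_λ^m(t) − 1)/m, so that W(n,k) = B k n.
    module A = Normalised mR (- 1#) lam factorA factorG (D-fall (- 1#) mR)
                          (D-log lam mR factorG (x*x⁻¹≈1 lam lam≉0) refl (λ _ → refl)) refl refl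
    module B = Normalised lam 1# mR (eDeg lam 1#) whitArg (D-fall 1# lam)
                          (D-log mR lam whitArg (x*x⁻¹≈1 mR (natR≉0 m 1≤m)) refl (λ _ → refl)) refl refl

    open Inverse mR lam (- 1#) 1# (-‿inverseˡ 1#) A.N B.N A.D-N B.D-N A.N-zero B.N-zero A.N-vanish public
      using (inverse-apply)

    coeffC-coord : ∀ n p k → coeffC n p k ≈ sumTo n (λ a → coord n p a * A.N k a)
    coeffC-coord n p k = begin
      inv (factR k) * pairing n (A.U k) p                   ≈⟨ *-congˡ (pairing-coord n (A.U k) p) ⟩
      inv (factR k) * sumTo n (λ a → coord n p a * A.U k a)  ≈⟨ sumTo-distribˡ n _ _ ⟨
      sumTo n (λ a → inv (factR k) * (coord n p a * A.U k a)) ≈⟨ sumTo-cong n (λ a → x*yz≈y*xz _ _ _) ⟩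
      sumTo n (λ a → coord n p a * A.N k a)                  ∎

    dowling-extend : ∀ n k → k ≤ n → ∀ i → dowling k i ≈ sumTo n (λ l → B.N l k * polyFall lam l i)
    dowling-extend n k k≤n i =
      sym (sumTo-truncate k n _ k≤n (λ l k<l _ → trans (*-congʳ (B.N-vanish k l k<l)) (zeroˡ _)))

theorem9 : ∀ {c ℓ : Level} (R : CommutativeRing c ℓ) (inv : CommutativeRing.Carrier R → CommutativeRing.Carrier R) →
    let open CommutativeRing R in
    let open FD R inv in
    (∀ x → ¬ (x ≈ 0#) → x * inv x ≈ 1#) →
    (∀ n → ¬ (natR (suc n) ≈ 0#)) →
    (lam : Carrier) → ¬ (lam ≈ 0#) →
    (m : ℕ) → 1 ≤ m →
    (n : ℕ) → (p : Poly) → (∀ i → n < i → p i ≈ 0#) →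
    let open Params lam m in
    ∀ i → p i ≈ sumTo n (λ k → coeffC n p k * dowling k i)
theorem9 R inv x*x⁻¹≈1 natR-suc≉0 lam lam≉0 m 1≤m n p p-deg i = begin
  p i
    ≈⟨ coord-expansion n p p-deg i ⟨
  sumTo n (λ a → x a * F a)
    ≈⟨ sumTo-cong≤ n (λ a a≤n → *-congˡ (inverse-apply n a a≤n F)) ⟨
  sumTo n (λ a → x a * sumTo n (λ l → sumTo n (λ k → A.N k a * B.N l k) * F l))
    ≈⟨ sumTo-bilinear-assoc n x F A.N (λ l k → B.N l k) ⟨
  sumTo n (λ k → sumTo n (λ a → x a * A.N k a) * sumTo n (λ l → B.N l k * F l))
    ≈⟨ sumTo-cong≤ n (λ k k≤n → *-cong (coeffC-coord n p k) (dowling-extend n k k≤n i)) ⟨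
  sumTo n (λ k → coeffC n p k * dowling k i)
    ∎
  where
  open CommutativeRing R
  open FD R inv
  open Params lam m
  open Dowling R inv
  open Coordinates lam m
  open Families x*x⁻¹≈1 natR-suc≉0 lam lam≉0 m 1≤m
  open SetoidReasoning setoid
  x : ℕ → Carrier
  x = coord n p
  F : ℕ → Carrier
  F l = polyFall lam l i
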